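{- $$\lim_{n\to\infty}\rho(n)^{1/n}\ge 10^{1/4}.$$
   Context: Permutations of $[n]=\{1,\dots,n\}$ are written as sequences $(\pi(1),\dots,\pi(n))$. Two permutations $\pi,\sigma$ of $[n]$ are colliding if there is a position $i$ with $|\pi(i)-\sigma(i)|=1$. $\rho(n)$ is the maximum cardinality of a set of pairwise colliding permutations of $[n]$. -}

module Defs where

open import Data.Nat using (ℕ; ∣_-_∣; _≤_)
open import Data.Fin using (Fin; toℕ)
open import Data.Fin.Permutation using (Permutation′; _⟨$⟩ʳ_)
open import Data.Product using (Σ; ∃; _×_)
open import Relation.Binary.PropositionalEquality using (_≡_; _≢_)

-- Permutations of [n] are represented as permutations of Fin n = {0,…,n-1}
-- (a uniform shift of values by 1, irrelevant for |π(i) - σ(i)| = 1).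

Colliding : {n : ℕ} → Permutation′ n → Permutation′ n → Set
Colliding {n} π σ =
  ∃ λ (i : Fin n) → ∣ toℕ (π ⟨$⟩ʳ i) - toℕ (σ ⟨$⟩ʳ i) ∣ ≡ 1

-- A family of k permutations of [n], pairwise colliding.
-- (Colliding permutations are automatically distinct, so such a family
-- is exactly a set of k pairwise colliding permutations.)
PairwiseCollidingFamily : (n k : ℕ) → Set
PairwiseCollidingFamily n k =
  Σ (Fin k → Permutation′ n) λ F → (i j : Fin k) → i ≢ j → Colliding (F i) (F j)

-- "ρ(n) ≥ m": there is a set of m pairwise colliding permutations of [n]
-- (ρ(n) is the maximum such cardinality).
ρ≥ : ℕ → ℕ → Set
ρ≥ n m = PairwiseCollidingFamily n m

module Submission where

-- Call a collision of π and σ at position i positive if π(i) and σ(i) are both nonzero (values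
-- in 0…n-1). Given π on [m+1] and g on [5], overlaying π shifted up by 4 with g, so that π's value
-- 0 and g's value 4 share a position, gives a permutation of [m+5]. Positive collisions of the
-- π-parts survive the shift and positive collisions of the g-parts survive unchanged, so a family
-- of K pairwise positively colliding permutations of [m+1] and one of L of [5] glue to a family of
-- K·L of [m+5]. There are ten permutations of [5] colliding pairwise positively, so iterating gives
-- 10ᵏ pairwise colliding permutations of [4k+1]; Bernoulli's inequality turns a⁴ < 10·b⁴ into
-- aⁿ ≤ 10ᵏ·bⁿ once k = ⌊(n-1)/4⌋ is large.

open import Defs
open import Data.Nat using (ℕ; _*_; _^_; _≤_; _<_; NonZero)
open import Data.Product using (∃; _×_)

open import Data.Nat using (zero; suc; _+_; _∸_; ∣_-_∣; z≤n; s≤s; _/_; _%_; _<?_)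
open import Data.Nat.Properties
open import Data.Nat.DivMod using (m≡m%n+[m/n]*n; m%n<n; m/n*n≤m; m*n/n≡m; /-monoˡ-≤)
open import Data.Nat.Tactic.RingSolver using (solve-∀)
open import Data.Fin as Fin using (Fin; toℕ; join; _↑ˡ_; _↑ʳ_)
open import Data.Fin.Patterns
open import Data.Fin.Properties as FinP
  using (+↔⊎; *↔×; splitAt-↑ˡ; splitAt-↑ʳ; toℕ-↑ˡ; toℕ-↑ʳ; any?; all?)
open import Data.Fin.Permutation as Perm
  using (Permutation′; _⟨$⟩ʳ_; _⟨$⟩ˡ_; permutation; inverseʳ; _∘ₚ_)
open import Data.Vec using (Vec; []; _∷_; lookup)
open import Data.Product using (Σ; _,_)
import Data.Sum as Sum
open import Data.Sum.Function.Propositional using (_⊎-↔_)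
open import Data.Empty using (⊥-elim)
open import Function using (_↣_; Injection; _∘_)
open import Function.Properties.Inverse using (↔-sym; ↔-trans; ↔⇒↣)
open import Relation.Nullary using (Dec; ¬?; yes; no)
open import Relation.Nullary.Decidable using (True; toWitness; _×-dec_; _→-dec_)
open import Relation.Binary using (DecidableEquality)
open import Relation.Binary.PropositionalEquality

Adjacent⁺ : ℕ → ℕ → Set
Adjacent⁺ x y = ∣ x - y ∣ ≡ 1 × 0 < x × 0 < y

adjacent⁺? : (x y : ℕ) → Dec (Adjacent⁺ x y)
adjacent⁺? x y = (∣ x - y ∣ ≟ 1) ×-dec (0 <? x) ×-dec (0 <? y)

Adjacent⁺-shift : ∀ s {x y} → Adjacent⁺ x y → Adjacent⁺ (suc s + x) (suc s + y)
Adjacent⁺-shift s {x} {y} (d , _ , _) = trans (∣m+n-m+o∣≡∣n-o∣ (suc s) x y) d , s≤s z≤n , s≤s z≤n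

PositivelyColliding : {n : ℕ} → Permutation′ n → Permutation′ n → Set
PositivelyColliding {n} π σ = ∃ λ (i : Fin n) → Adjacent⁺ (toℕ (π ⟨$⟩ʳ i)) (toℕ (σ ⟨$⟩ʳ i))

positivelyColliding? : {n : ℕ} (π σ : Permutation′ n) → Dec (PositivelyColliding π σ)
positivelyColliding? π σ = any? λ i → adjacent⁺? (toℕ (π ⟨$⟩ʳ i)) (toℕ (σ ⟨$⟩ʳ i))

PositivelyCollidingFamily : ℕ → Set → Set
PositivelyCollidingFamily n I =
  Σ (I → Permutation′ n) λ F → (i j : I) → i ≢ j → PositivelyColliding (F i) (F j)

forgetPositivity : ∀ {n k} → PositivelyCollidingFamily n (Fin k) → ρ≥ n k
forgetPositivity (F , coll) = F , λ i j i≢j → let (p , d , _) = coll i j i≢j in p , d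

reindex : ∀ {n} {I J : Set} → J ↣ I → PositivelyCollidingFamily n I → PositivelyCollidingFamily n J
reindex ι (F , coll) = (λ j → F (to j)) , λ j j' j≢j' → coll (to j) (to j') (λ eq → j≢j' (injective eq))
  where open Injection ι

pairwisePositivelyColliding? : ∀ {n k} (F : Fin k → Permutation′ n) →
  Dec ((i j : Fin k) → i ≢ j → PositivelyColliding (F i) (F j))
pairwisePositivelyColliding? F =
  all? λ i → all? λ j → ¬? (i FinP.≟ j) →-dec positivelyColliding? (F i) (F j)

fromInverses : ∀ {n} (f g : Vec (Fin n) n) →
  {True (all? λ i → lookup f (lookup g i) FinP.≟ i)} →
  {True (all? λ i → lookup g (lookup f i) FinP.≟ i)} → Permutation′ n
fromInverses f g {fg} {gf} = permutation (lookup f) (lookup g) (toWitness fg) (toWitness gf)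

tenPermutations : Fin 10 → Permutation′ 5
tenPermutations = lookup
  ( fromInverses (4F ∷ 2F ∷ 3F ∷ 1F ∷ 0F ∷ []) (4F ∷ 3F ∷ 1F ∷ 2F ∷ 0F ∷ [])
  ∷ fromInverses (4F ∷ 1F ∷ 0F ∷ 3F ∷ 2F ∷ []) (2F ∷ 1F ∷ 4F ∷ 3F ∷ 0F ∷ [])
  ∷ fromInverses (3F ∷ 4F ∷ 1F ∷ 0F ∷ 2F ∷ []) (3F ∷ 2F ∷ 4F ∷ 0F ∷ 1F ∷ [])
  ∷ fromInverses (3F ∷ 0F ∷ 2F ∷ 1F ∷ 4F ∷ []) (1F ∷ 3F ∷ 2F ∷ 0F ∷ 4F ∷ [])
  ∷ fromInverses (2F ∷ 3F ∷ 1F ∷ 4F ∷ 0F ∷ []) (4F ∷ 2F ∷ 0F ∷ 1F ∷ 3F ∷ [])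
  ∷ fromInverses (2F ∷ 0F ∷ 4F ∷ 3F ∷ 1F ∷ []) (1F ∷ 4F ∷ 0F ∷ 3F ∷ 2F ∷ [])
  ∷ fromInverses (1F ∷ 3F ∷ 0F ∷ 2F ∷ 4F ∷ []) (2F ∷ 0F ∷ 3F ∷ 1F ∷ 4F ∷ [])
  ∷ fromInverses (1F ∷ 2F ∷ 4F ∷ 0F ∷ 3F ∷ []) (3F ∷ 0F ∷ 1F ∷ 4F ∷ 2F ∷ [])
  ∷ fromInverses (0F ∷ 4F ∷ 3F ∷ 2F ∷ 1F ∷ []) (0F ∷ 4F ∷ 3F ∷ 2F ∷ 1F ∷ [])
  ∷ fromInverses (0F ∷ 1F ∷ 2F ∷ 4F ∷ 3F ∷ []) (0F ∷ 1F ∷ 2F ∷ 4F ∷ 3F ∷ [])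
  ∷ [])

tenfold : PositivelyCollidingFamily 5 (Fin 10)
tenfold = tenPermutations , toWitness {a? = pairwisePositivelyColliding? tenPermutations} _

_⊕_ : ∀ {m n} → Permutation′ m → Permutation′ n → Permutation′ (m + n)
π ⊕ σ = ↔-trans +↔⊎ (↔-trans (π ⊎-↔ σ) (↔-sym +↔⊎))

⊕-↑ˡ : ∀ {m n} (π : Permutation′ m) (σ : Permutation′ n) i → (π ⊕ σ) ⟨$⟩ʳ (i ↑ˡ n) ≡ (π ⟨$⟩ʳ i) ↑ˡ n
⊕-↑ˡ {m} {n} π σ i = cong (join m n ∘ Sum.map (π ⟨$⟩ʳ_) (σ ⟨$⟩ʳ_)) (splitAt-↑ˡ m i n)

⊕-↑ʳ : ∀ {m n} (π : Permutation′ m) (σ : Permutation′ n) i → (π ⊕ σ) ⟨$⟩ʳ (m ↑ʳ i) ≡ m ↑ʳ (σ ⟨$⟩ʳ i)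
⊕-↑ʳ {m} {n} π σ i = cong (join m n ∘ Sum.map (π ⟨$⟩ʳ_) (σ ⟨$⟩ʳ_)) (splitAt-↑ʳ m n i)

toℕ-⊕-↑ˡ : ∀ {m n} (π : Permutation′ m) (σ : Permutation′ n) i → toℕ ((π ⊕ σ) ⟨$⟩ʳ (i ↑ˡ n)) ≡ toℕ (π ⟨$⟩ʳ i)
toℕ-⊕-↑ˡ {n = n} π σ i = trans (cong toℕ (⊕-↑ˡ π σ i)) (toℕ-↑ˡ (π ⟨$⟩ʳ i) n)

ρ≥-mono : ∀ {n n' k} → n ≤ n' → ρ≥ n k → ρ≥ n' k
ρ≥-mono {n} {n'} n≤n' (F , coll) = subst (λ N → ρ≥ N _) (m+[n∸m]≡n n≤n') (padded , padded-coll)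
  where
  padded = λ i → F i ⊕ Perm.id {n' ∸ n}
  padded-coll : ∀ i j → i ≢ j → Colliding (padded i) (padded j)
  padded-coll i j i≢j with coll i j i≢j
  ... | p , d = p ↑ˡ (n' ∸ n) ,
    subst₂ (λ x y → ∣ x - y ∣ ≡ 1) (sym (toℕ-⊕-↑ˡ (F i) Perm.id p)) (sym (toℕ-⊕-↑ˡ (F j) Perm.id p)) d

module _ {m : ℕ} where

  glue : Permutation′ (suc m) → Permutation′ 5 → Permutation′ (4 + suc m)
  glue π g = (Perm.id {4} ⊕ π) ∘ₚ (g ⊕ Perm.id {m})

  glue-high : ∀ π g i → 0 < toℕ (π ⟨$⟩ʳ i) → toℕ (glue π g ⟨$⟩ʳ (4 ↑ʳ i)) ≡ 4 + toℕ (π ⟨$⟩ʳ i)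
  glue-high π g i pos with π ⟨$⟩ʳ i
  ... | Fin.suc v = toℕ-↑ʳ 5 v

  gluedPosition : Permutation′ (suc m) → Fin 5 → Fin (4 + suc m)
  gluedPosition π j = (Perm.id {4} ⊕ π) ⟨$⟩ˡ (j ↑ˡ m)

  glue-low : ∀ π g j → toℕ (glue π g ⟨$⟩ʳ gluedPosition π j) ≡ toℕ (g ⟨$⟩ʳ j)
  glue-low π g j =
    trans (cong (λ x → toℕ ((g ⊕ Perm.id {m}) ⟨$⟩ʳ x)) (inverseʳ (Perm.id {4} ⊕ π) {j ↑ˡ m}))
          (toℕ-⊕-↑ˡ g Perm.id j)

  glue-collides-high : ∀ π π' g g' → PositivelyColliding π π' → PositivelyColliding (glue π g) (glue π' g')
  glue-collides-high π π' g g' (i , adj@(_ , pos , pos')) =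
    4 ↑ʳ i , subst₂ Adjacent⁺ (sym (glue-high π g i pos)) (sym (glue-high π' g' i pos')) (Adjacent⁺-shift 3 adj)

  glue-collides-low : ∀ π g g' → PositivelyColliding g g' → PositivelyColliding (glue π g) (glue π g')
  glue-collides-low π g g' (j , adj) =
    gluedPosition π j , subst₂ Adjacent⁺ (sym (glue-low π g j)) (sym (glue-low π g' j)) adj

glueFamily : ∀ {m} {I J : Set} → DecidableEquality I →
  PositivelyCollidingFamily (suc m) I → PositivelyCollidingFamily 5 J →
  PositivelyCollidingFamily (4 + suc m) (J × I)
glueFamily {I = I} {J} _≟_ (F , collF) (G , collG) = glued , coll
  where
  glued : J × I → Permutation′ _
  glued (j , i) = glue (F i) (G j)
  coll : (p q : J × I) → p ≢ q → PositivelyColliding (glued p) (glued q)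
  coll (j , i) (j' , i') p≢q with i ≟ i'
  ... | no i≢i' = glue-collides-high (F i) (F i') (G j) (G j') (collF i i' i≢i')
  ... | yes refl = glue-collides-low (F i) (G j) (G j') (collG j j' λ j≡j' → p≢q (cong (_, i) j≡j'))

powerFamily : ∀ k → PositivelyCollidingFamily (suc (k * 4)) (Fin (10 ^ k))
powerFamily zero = (λ _ → Perm.id) , λ { 0F 0F 0≢0 → ⊥-elim (0≢0 refl) }
powerFamily (suc k) = reindex (↔⇒↣ *↔×) (glueFamily FinP._≟_ (powerFamily k) tenfold)

^-distribʳ-* : ∀ x y k → (x * y) ^ k ≡ x ^ k * y ^ k
^-distribʳ-* x y zero = refl
^-distribʳ-* x y (suc k) = trans (cong (x * y *_) (^-distribʳ-* x y k)) (interchange x y (x ^ k) (y ^ k))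
  where
  interchange : ∀ x y X Y → x * y * (X * Y) ≡ x * X * (y * Y)
  interchange = solve-∀

-- Bernoulli's inequality (1 + 1/c)ᵏ ≥ 1 + k/c, cleared of denominators.
bernoulli : ∀ c k → c ^ k * (c + k) ≤ c * suc c ^ k
bernoulli c zero = ≤-reflexive (base c)
  where
  base : ∀ c → 1 * (c + 0) ≡ c * 1
  base = solve-∀
bernoulli c (suc k) = begin
  c * c ^ k * (c + suc k)              ≡⟨ cong (c * c ^ k *_) (+-suc c k) ⟩
  c * c ^ k * suc (c + k)              ≡⟨ expand c k (c ^ k) ⟩
  c * (c ^ k * (c + k)) + c * c ^ k    ≤⟨ +-mono-≤ (*-monoʳ-≤ c (bernoulli c k)) (*-monoʳ-≤ c (^-monoˡ-≤ k (n≤1+n c))) ⟩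
  c * (c * suc c ^ k) + c * suc c ^ k  ≡⟨ collect c (suc c ^ k) ⟩
  c * suc c ^ suc k                    ∎
  where
  open ≤-Reasoning
  expand : ∀ c k X → c * X * suc (c + k) ≡ c * (X * (c + k)) + c * X
  expand = solve-∀
  collect : ∀ c Y → c * (c * Y) + c * Y ≡ c * (Y + c * Y)
  collect = solve-∀

^-overtake : ∀ {c d} k → c < d → c * c ≤ k → c ^ suc k ≤ d ^ k
^-overtake {zero} k _ _ = z≤n
^-overtake {c@(suc _)} {d} k c<d c²≤k = *-cancelˡ-≤ c (begin
  c * (c * c ^ k)  ≡⟨ rearrange c (c ^ k) ⟩
  c ^ k * (c * c)  ≤⟨ *-monoʳ-≤ (c ^ k) (≤-trans c²≤k (m≤n+m k c)) ⟩
  c ^ k * (c + k)  ≤⟨ bernoulli c k ⟩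
  c * suc c ^ k    ≤⟨ *-monoʳ-≤ c (^-monoˡ-≤ k c<d) ⟩
  c * d ^ k        ∎)
  where
  open ≤-Reasoning
  rearrange : ∀ c X → c * (c * X) ≡ X * (c * c)
  rearrange = solve-∀

power-gap-bound : ∀ a b {d e k n} .{{_ : NonZero b}} → a ^ e < d * b ^ e → a ^ e * a ^ e ≤ k →
  k * e ≤ suc n → suc n ≤ suc k * e → a ^ suc n ≤ d ^ k * b ^ suc n
power-gap-bound zero _ _ _ _ _ = z≤n
power-gap-bound a@(suc _) b {d} {e} {k} {n} aᵉ<dbᵉ aᵉ²≤k ke≤n n≤[1+k]e = begin
  a ^ suc n              ≤⟨ ^-monoʳ-≤ a n≤[1+k]e ⟩
  a ^ (suc k * e)        ≡⟨ cong (a ^_) (*-comm (suc k) e) ⟩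
  a ^ (e * suc k)        ≡⟨ ^-*-assoc a e (suc k) ⟨
  (a ^ e) ^ suc k        ≤⟨ ^-overtake k aᵉ<dbᵉ aᵉ²≤k ⟩
  (d * b ^ e) ^ k        ≡⟨ ^-distribʳ-* d (b ^ e) k ⟩
  d ^ k * (b ^ e) ^ k    ≡⟨ cong (d ^ k *_) (trans (^-*-assoc b e k) (cong (b ^_) (*-comm e k))) ⟩
  d ^ k * b ^ (k * e)    ≤⟨ *-monoʳ-≤ (d ^ k) (^-monoʳ-≤ b ke≤n) ⟩
  d ^ k * b ^ suc n      ∎
  where open ≤-Reasoning

m<[1+m/n]*n : ∀ m n .{{_ : NonZero n}} → m < suc (m / n) * n
m<[1+m/n]*n m n = begin-strict
  m                  ≡⟨ m≡m%n+[m/n]*n m n ⟩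
  m % n + m / n * n  <⟨ +-monoˡ-< (m / n * n) (m%n<n m n) ⟩
  n + m / n * n      ∎
  where open ≤-Reasoning

proposition6 : (a b : ℕ) → .{{_ : NonZero b}} → a ^ 4 < 10 * b ^ 4 →
    ∃ λ (N : ℕ) → (n : ℕ) → N ≤ n →
    ∃ λ (m : ℕ) → ρ≥ n m × a ^ n ≤ m * b ^ n
proposition6 a b a⁴<10b⁴ = suc (a ^ 4 * a ^ 4 * 4) , λ where
  (suc n) (s≤s N≤n) →
    let k = n / 4
        a⁸≤k = subst (_≤ k) (m*n/n≡m (a ^ 4 * a ^ 4) 4) (/-monoˡ-≤ 4 N≤n)
        4k≤n = m/n*n≤m n 4
    in 10 ^ k
       , ρ≥-mono (s≤s 4k≤n) (forgetPositivity (powerFamily k))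
       , power-gap-bound a b a⁴<10b⁴ a⁸≤k (m≤n⇒m≤1+n 4k≤n) (m<[1+m/n]*n n 4)
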